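{- Let $M$ be a uniform matroid of rank $r$ on $E=\{e_1,\dots,e_n\}$, $k\ge1$, and let each $e_i$ be active independently with probability $p_i$, where $p_1\ge\dots\ge p_n$; let $A$ be the random set of active elements. Assume $\mathrm{OPT}\ge200$. Let $M^*$ be the largest index with $\sum_{i=1}^{M^*}p_i<\mathrm{OPT}/2$, and let $L=\{e_{M^*+1},\dots,e_n\}$. If $\{O_1,\dots,O_k\}$ is an optimal portfolio, then $$\mathbb{E}_A\Big[\max_{i\in[k]}|O_i\cap L\cap A|\Big]\ge\frac{\mathrm{OPT}}{2}.$$
   Context: A portfolio is a collection of $k$ subsets of $E$ each of size at most $r$, with value $\mathbb{E}_A[\max_i|S_i\cap A|]$; $\mathrm{OPT}$ is the maximum value and an optimal portfolio attains it.
   Formalization: The activation probabilities $p_i$ are rational numbers in [0,1]. -}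

module Defs where

open import Data.Nat as ℕ using (ℕ; zero; suc; _⊔_; _≤ᵇ_)
open import Data.Fin using (Fin; toℕ)
import Data.Fin as Fin
open import Data.Fin.Subset using (Subset; inside; outside; _∩_; ∣_∣)
open import Data.Vec using (Vec; []; _∷_; tabulate)
open import Data.Integer using (+_)
open import Data.Rational using (ℚ; 0ℚ; 1ℚ; _+_; _*_; _-_; _/_; _≤_; _<_)

toℚ : ℕ → ℚ
toℚ m = (+ m) / 1

-- Expectation of f(A) where A ⊆ Fin n is the random set in which element i
-- is present independently with probability p i.
𝔼 : (n : ℕ) → (Fin n → ℚ) → (Subset n → ℚ) → ℚ
𝔼 zero    p f = f []
𝔼 (suc n) p f =
  p Fin.zero * 𝔼 n (λ i → p (Fin.suc i)) (λ A → f (inside ∷ A))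
  + (1ℚ - p Fin.zero) * 𝔼 n (λ i → p (Fin.suc i)) (λ A → f (outside ∷ A))

maxFin : (k : ℕ) → (Fin k → ℕ) → ℕ
maxFin zero    g = 0
maxFin (suc k) g = g Fin.zero ⊔ maxFin k (λ i → g (Fin.suc i))

Portfolio : ℕ → ℕ → Set
Portfolio n k = Fin k → Subset n

-- Feasible for the uniform matroid of rank r: each set has size at most r
Feasible : (n k r : ℕ) → Portfolio n k → Set
Feasible n k r S = (i : Fin k) → ∣ S i ∣ ℕ.≤ r

valueOn : (n k : ℕ) → (Fin n → ℚ) → Portfolio n k → Subset n → ℚ
valueOn n k p S B = 𝔼 n p (λ A → toℚ (maxFin k (λ i → ∣ S i ∩ B ∩ A ∣)))

value : (n k : ℕ) → (Fin n → ℚ) → Portfolio n k → ℚ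
value n k p S = 𝔼 n p (λ A → toℚ (maxFin k (λ i → ∣ S i ∩ A ∣)))

Optimal : (n k r : ℕ) → (Fin n → ℚ) → Portfolio n k → Set
Optimal n k r p O =
  Feasible n k r O × ((S : Portfolio n k) → Feasible n k r S → value n k p S ≤ value n k p O)
  where open import Data.Product using (_×_)

-- prefix sum  p_1 + ... + p_m  (0-indexed: p 0 + ... + p (m-1)), m ≤ n
prefixSum : (n : ℕ) → (Fin n → ℚ) → ℕ → ℚ
prefixSum n       p zero    = 0ℚ
prefixSum zero    p (suc m) = 0ℚ
prefixSum (suc n) p (suc m) = p Fin.zero + prefixSum n (λ i → p (Fin.suc i)) m

-- L = {e_{M*+1},...,e_n}, i.e. 0-indexed elements with index ≥ M*
tailSet : (n : ℕ) → ℕ → Subset n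
tailSet n M = tabulate (λ i → if M ≤ᵇ toℕ i then inside else outside)
  where open import Data.Bool using (if_then_else_)

-- Every active element outside L is one of the first M* elements, so for each
-- set O_i we have |O_i ∩ A| ≤ |O_i ∩ L ∩ A| + |A ∖ L|.  Taking the maximum over i
-- and then expectations gives OPT ≤ 𝔼[max_i |O_i ∩ L ∩ A|] + (p_1 + … + p_{M*}),
-- and the prefix sum is below OPT/2 by the choice of M*.
module Submission where

open import Defs
open import Data.Nat as ℕ using (ℕ; zero; suc; _<ᵇ_; _≤ᵇ_)
import Data.Nat.Properties as ℕ
open import Data.Fin using (Fin; toℕ)
import Data.Fin as Fin
open import Data.Fin.Subset using (Subset; inside; outside; _∩_; ∣_∣; ∁)
open import Data.Vec using ([]; _∷_)
open import Data.Vec.Properties using (tabulate-cong)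
open import Data.Bool using (true; false; if_then_else_)
open import Data.Product using (_×_; proj₁; proj₂)
open import Data.Integer as ℤ using (+_)
import Data.Integer.Properties as ℤ
open import Data.Rational using (ℚ; mkℚ; 0ℚ; 1ℚ; ½; _+_; _-_; -_; _*_; _≤_; _<_; *≤*; nonNegative)
open import Data.Rational.Properties
open import Data.Rational.Solver using (module +-*-Solver)
open import Data.Nat.Coprimality using (1-coprimeTo) renaming (sym to coprime-sym)
open import Relation.Binary.PropositionalEquality

open +-*-Solver using (solve; _:+_; _:*_; :-_; _:=_; con)

toℚ≡mkℚ : ∀ m → toℚ m ≡ mkℚ (+ m) 0 (coprime-sym (1-coprimeTo m))
toℚ≡mkℚ m = normalize-coprime (coprime-sym (1-coprimeTo m))

toℚ-homo-+ : ∀ m n → toℚ (m ℕ.+ n) ≡ toℚ m + toℚ n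
toℚ-homo-+ m n rewrite toℚ≡mkℚ m | toℚ≡mkℚ n =
  /-cong (sym (cong₂ ℤ._+_ (ℤ.*-identityʳ (+ m)) (ℤ.*-identityʳ (+ n)))) refl

toℚ-mono-≤ : ∀ {m n} → m ℕ.≤ n → toℚ m ≤ toℚ n
toℚ-mono-≤ {m} {n} m≤n rewrite toℚ≡mkℚ m | toℚ≡mkℚ n =
  *≤* (subst₂ ℤ._≤_ (sym (ℤ.*-identityʳ (+ m))) (sym (ℤ.*-identityʳ (+ n))) (ℤ.+≤+ m≤n))

p≤1⇒0≤1-p : ∀ {p} → p ≤ 1ℚ → 0ℚ ≤ 1ℚ - p
p≤1⇒0≤1-p {p} p≤1 = subst (_≤ 1ℚ - p) (+-inverseʳ p) (+-monoˡ-≤ (- p) p≤1)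

Probabilities : (n : ℕ) → (Fin n → ℚ) → Set
Probabilities n p = (i : Fin n) → (0ℚ ≤ p i) × (p i ≤ 1ℚ)

𝔼-cong : ∀ n p {f g : Subset n → ℚ} → (∀ A → f A ≡ g A) → 𝔼 n p f ≡ 𝔼 n p g
𝔼-cong zero    p f≡g = f≡g []
𝔼-cong (suc n) p f≡g =
  cong₂ (λ x y → p Fin.zero * x + (1ℚ - p Fin.zero) * y)
    (𝔼-cong n _ (λ A → f≡g (inside ∷ A)))
    (𝔼-cong n _ (λ A → f≡g (outside ∷ A)))

𝔼-const : ∀ n p c → 𝔼 n p (λ _ → c) ≡ c
𝔼-const zero    p c = refl
𝔼-const (suc n) p c rewrite 𝔼-const n (λ i → p (Fin.suc i)) c =
  solve 2 (λ x c → x :* c :+ (con 1ℚ :+ :- x) :* c := c) refl (p Fin.zero) c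

𝔼-distrib-+ : ∀ n p (f g : Subset n → ℚ) → 𝔼 n p (λ A → f A + g A) ≡ 𝔼 n p f + 𝔼 n p g
𝔼-distrib-+ zero    p f g = refl
𝔼-distrib-+ (suc n) p f g
  rewrite 𝔼-distrib-+ n (λ i → p (Fin.suc i)) (λ A → f (inside ∷ A)) (λ A → g (inside ∷ A))
        | 𝔼-distrib-+ n (λ i → p (Fin.suc i)) (λ A → f (outside ∷ A)) (λ A → g (outside ∷ A)) =
  solve 5 (λ x a b c d → x :* (a :+ b) :+ (con 1ℚ :+ :- x) :* (c :+ d)
             := (x :* a :+ (con 1ℚ :+ :- x) :* c) :+ (x :* b :+ (con 1ℚ :+ :- x) :* d))
    refl (p Fin.zero) _ _ _ _

𝔼-mono-≤ : ∀ n p → Probabilities n p →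
           {f g : Subset n → ℚ} → (∀ A → f A ≤ g A) → 𝔼 n p f ≤ 𝔼 n p g
𝔼-mono-≤ zero    p prob f≤g = f≤g []
𝔼-mono-≤ (suc n) p prob f≤g =
  +-mono-≤ (*-monoˡ-≤-nonNeg (p Fin.zero) {{nonNegative (proj₁ (prob Fin.zero))}}
              (𝔼-mono-≤ n p′ prob′ (λ A → f≤g (inside ∷ A))))
           (*-monoˡ-≤-nonNeg (1ℚ - p Fin.zero) {{nonNegative (p≤1⇒0≤1-p (proj₂ (prob Fin.zero)))}}
              (𝔼-mono-≤ n p′ prob′ (λ A → f≤g (outside ∷ A))))
  where
  p′ : Fin n → ℚ
  p′ i = p (Fin.suc i)
  prob′ : Probabilities n p′
  prob′ i = prob (Fin.suc i)

∣X∩A∣≤∣X∩B∩A∣+∣∁B∩A∣ : ∀ {n} (X B A : Subset n) → ∣ X ∩ A ∣ ℕ.≤ ∣ X ∩ B ∩ A ∣ ℕ.+ ∣ ∁ B ∩ A ∣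
∣X∩A∣≤∣X∩B∩A∣+∣∁B∩A∣ [] [] [] = ℕ.z≤n
∣X∩A∣≤∣X∩B∩A∣+∣∁B∩A∣ (true  ∷ X) (true  ∷ B) (true  ∷ A) = ℕ.s≤s (∣X∩A∣≤∣X∩B∩A∣+∣∁B∩A∣ X B A)
∣X∩A∣≤∣X∩B∩A∣+∣∁B∩A∣ (true  ∷ X) (false ∷ B) (true  ∷ A) =
  subst (suc ∣ X ∩ A ∣ ℕ.≤_) (sym (ℕ.+-suc ∣ X ∩ B ∩ A ∣ ∣ ∁ B ∩ A ∣)) (ℕ.s≤s (∣X∩A∣≤∣X∩B∩A∣+∣∁B∩A∣ X B A))
∣X∩A∣≤∣X∩B∩A∣+∣∁B∩A∣ (false ∷ X) (false ∷ B) (true  ∷ A) =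
  ℕ.≤-trans (∣X∩A∣≤∣X∩B∩A∣+∣∁B∩A∣ X B A) (ℕ.+-monoʳ-≤ _ (ℕ.n≤1+n _))
∣X∩A∣≤∣X∩B∩A∣+∣∁B∩A∣ (false ∷ X) (true  ∷ B) (true  ∷ A) = ∣X∩A∣≤∣X∩B∩A∣+∣∁B∩A∣ X B A
∣X∩A∣≤∣X∩B∩A∣+∣∁B∩A∣ (true  ∷ X) (true  ∷ B) (false ∷ A) = ∣X∩A∣≤∣X∩B∩A∣+∣∁B∩A∣ X B A
∣X∩A∣≤∣X∩B∩A∣+∣∁B∩A∣ (true  ∷ X) (false ∷ B) (false ∷ A) = ∣X∩A∣≤∣X∩B∩A∣+∣∁B∩A∣ X B A
∣X∩A∣≤∣X∩B∩A∣+∣∁B∩A∣ (false ∷ X) (true  ∷ B) (false ∷ A) = ∣X∩A∣≤∣X∩B∩A∣+∣∁B∩A∣ X B A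
∣X∩A∣≤∣X∩B∩A∣+∣∁B∩A∣ (false ∷ X) (false ∷ B) (false ∷ A) = ∣X∩A∣≤∣X∩B∩A∣+∣∁B∩A∣ X B A

maxFin-≤-+ : ∀ k (g h : Fin k → ℕ) c → (∀ i → g i ℕ.≤ h i ℕ.+ c) → maxFin k g ℕ.≤ maxFin k h ℕ.+ c
maxFin-≤-+ zero    g h c g≤h+c = ℕ.z≤n
maxFin-≤-+ (suc k) g h c g≤h+c =
  ℕ.⊔-lub (ℕ.≤-trans (g≤h+c Fin.zero) (ℕ.+-monoˡ-≤ c (ℕ.m≤m⊔n _ _)))
          (ℕ.≤-trans (maxFin-≤-+ k _ _ c (λ i → g≤h+c (Fin.suc i))) (ℕ.+-monoˡ-≤ c (ℕ.m≤n⊔m _ _)))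

value≤valueOn+𝔼∣∁B∩A∣ : ∀ n k p → Probabilities n p → (S : Portfolio n k) (B : Subset n) →
                        value n k p S ≤ valueOn n k p S B + 𝔼 n p (λ A → toℚ ∣ ∁ B ∩ A ∣)
value≤valueOn+𝔼∣∁B∩A∣ n k p prob S B = ≤-trans
  (𝔼-mono-≤ n p prob pointwise)
  (≤-reflexive (𝔼-distrib-+ n p _ _))
  where
  pointwise : ∀ A → toℚ (maxFin k (λ i → ∣ S i ∩ A ∣))
                    ≤ toℚ (maxFin k (λ i → ∣ S i ∩ B ∩ A ∣)) + toℚ ∣ ∁ B ∩ A ∣
  pointwise A = subst (toℚ (maxFin k inS) ≤_) (toℚ-homo-+ (maxFin k inSB) ∣ ∁ B ∩ A ∣)
    (toℚ-mono-≤ (maxFin-≤-+ k inS inSB ∣ ∁ B ∩ A ∣ (λ i → ∣X∩A∣≤∣X∩B∩A∣+∣∁B∩A∣ (S i) B A)))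
    where
    inS inSB : Fin k → ℕ
    inS  i = ∣ S i ∩ A ∣
    inSB i = ∣ S i ∩ B ∩ A ∣

<ᵇ-suc : ∀ m n → (m <ᵇ suc n) ≡ (m ≤ᵇ n)
<ᵇ-suc zero    n = refl
<ᵇ-suc (suc m) n = refl

tailSet-suc : ∀ n M → tailSet (suc n) (suc M) ≡ outside ∷ tailSet n M
tailSet-suc n M = cong (outside ∷_)
  (tabulate-cong (λ i → cong (λ b → if b then inside else outside) (<ᵇ-suc M (toℕ i))))

∣∁tailSet0∩A∣≡0 : ∀ n (A : Subset n) → ∣ ∁ (tailSet n 0) ∩ A ∣ ≡ 0
∣∁tailSet0∩A∣≡0 zero    []      = refl
∣∁tailSet0∩A∣≡0 (suc n) (_ ∷ A) = ∣∁tailSet0∩A∣≡0 n A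

𝔼∣∁tailSet∩A∣≡prefixSum : ∀ n p M → 𝔼 n p (λ A → toℚ ∣ ∁ (tailSet n M) ∩ A ∣) ≡ prefixSum n p M
𝔼∣∁tailSet∩A∣≡prefixSum n       p zero =
  trans (𝔼-cong n p (λ A → cong toℚ (∣∁tailSet0∩A∣≡0 n A))) (𝔼-const n p 0ℚ)
𝔼∣∁tailSet∩A∣≡prefixSum zero    p (suc M) = refl
𝔼∣∁tailSet∩A∣≡prefixSum (suc n) p (suc M) = begin
  𝔼 (suc n) p (λ A → toℚ ∣ ∁ (tailSet (suc n) (suc M)) ∩ A ∣)
    ≡⟨ 𝔼-cong (suc n) p (λ A → cong (λ T → toℚ ∣ ∁ T ∩ A ∣) (tailSet-suc n M)) ⟩
  p₀ * 𝔼 n p′ (λ A → toℚ (suc (count A))) + (1ℚ - p₀) * E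
    ≡⟨ cong (λ z → p₀ * z + (1ℚ - p₀) * E) 𝔼[1+count]≡1+E ⟩
  p₀ * (1ℚ + E) + (1ℚ - p₀) * E
    ≡⟨ solve 2 (λ x e → x :* (con 1ℚ :+ e) :+ (con 1ℚ :+ :- x) :* e := x :+ e) refl p₀ E ⟩
  p₀ + E
    ≡⟨ cong (λ z → p₀ + z) (𝔼∣∁tailSet∩A∣≡prefixSum n p′ M) ⟩
  prefixSum (suc n) p (suc M) ∎
  where
  open ≡-Reasoning
  p₀ = p Fin.zero
  p′ = λ i → p (Fin.suc i)
  count = λ A → ∣ ∁ (tailSet n M) ∩ A ∣
  E = 𝔼 n p′ (λ A → toℚ (count A))
  𝔼[1+count]≡1+E : 𝔼 n p′ (λ A → toℚ (suc (count A))) ≡ 1ℚ + E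
  𝔼[1+count]≡1+E = begin
    𝔼 n p′ (λ A → toℚ (suc (count A)))   ≡⟨ 𝔼-cong n p′ (λ A → toℚ-homo-+ 1 (count A)) ⟩
    𝔼 n p′ (λ A → 1ℚ + toℚ (count A))   ≡⟨ 𝔼-distrib-+ n p′ _ _ ⟩
    𝔼 n p′ (λ _ → 1ℚ) + E               ≡⟨ cong (_+ E) (𝔼-const n p′ 1ℚ) ⟩
    1ℚ + E                              ∎

p≤q+r⇒r<½p⇒½p<q : ∀ {p q r} → p ≤ q + r → r < ½ * p → ½ * p < q
p≤q+r⇒r<½p⇒½p<q {p} {q} {r} p≤q+r r<½p = begin-strict
  ½ * p                ≡⟨ solve 1 (λ p → con ½ :* p := p :+ :- (con ½ :* p)) refl p ⟩
  p - ½ * p            ≤⟨ +-monoˡ-≤ (- (½ * p)) p≤q+r ⟩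
  q + r - ½ * p        <⟨ +-monoˡ-< (- (½ * p)) (+-monoʳ-< q r<½p) ⟩
  q + ½ * p - ½ * p    ≡⟨ solve 2 (λ q x → q :+ x :+ :- x := q) refl q (½ * p) ⟩
  q                    ∎
  where open ≤-Reasoning

lemma4p1 : (n r k : ℕ) → 1 ℕ.≤ k →
    (p : Fin n → ℚ) →
    ((i : Fin n) → (0ℚ ≤ p i) × (p i ≤ 1ℚ)) →
    ((i j : Fin n) → toℕ i ℕ.≤ toℕ j → p j ≤ p i) →
    (O : Portfolio n k) → Optimal n k r p O →
    toℚ 200 ≤ value n k p O →
    (Mstar : ℕ) → Mstar ℕ.≤ n →
    prefixSum n p Mstar < ½ * value n k p O →
    ((m : ℕ) → m ℕ.≤ n → prefixSum n p m < ½ * value n k p O → m ℕ.≤ Mstar) →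
    ½ * value n k p O ≤ valueOn n k p O (tailSet n Mstar)
lemma4p1 n r k _ p prob _ O _ _ Mstar _ prefix<½value _ =
  <⇒≤ (p≤q+r⇒r<½p⇒½p<q value≤valueOnL+prefixSum prefix<½value)
  where
  value≤valueOnL+prefixSum : value n k p O ≤ valueOn n k p O (tailSet n Mstar) + prefixSum n p Mstar
  value≤valueOnL+prefixSum = subst (value n k p O ≤_)
    (cong (λ z → valueOn n k p O (tailSet n Mstar) + z) (𝔼∣∁tailSet∩A∣≡prefixSum n p Mstar))
    (value≤valueOn+𝔼∣∁B∩A∣ n k p prob O (tailSet n Mstar))
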